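{- Consider the Round-Robin protocol with $n$ agents over a finite item set $M$, as described in the context. Let $i$ be an agent with a normalized, nonnegative, monotone submodular objective $f_i$ and a $p_i$-system constraint $\mathcal{I}_i$, who follows the greedy policy, ending with set $S_i$. Let $j\neq i$ be any other agent (following an arbitrary policy), let $S_j$ be the set of items selected by agent $j$ during the protocol, and let $g$ be the first item selected by agent $j$. Define $S'_j=S_j$ if $i<j$ and $S'_j=S_j\setminus\{g\}$ otherwise. Then $f_i(S_i)\ge \max_{S\in\mathcal{I}_i|S'_j} f_i(S)/(p_i+2)$.
   Context: For $f:2^M\to\mathbb{R}$ write $f(x\,|\,S)=f(S\cup\{x\})-f(S)$; submodular means $f(x\,|\,S)\ge f(x\,|\,T)$ for $S\subseteq T$, $x\notin T$. An independence system is a family $\mathcal{I}\subseteq 2^M$ containing $\emptyset$ and closed under subsets; a basis of $S$ is a maximal member of $\mathcal{I}$ contained in $S$; $\mathrm{ur}(S)$, $\mathrm{lr}(S)$ are the largest and smallest basis cardinalities of $S$; a $p$-system is an independence system with $\max_{S\subseteq M}\mathrm{ur}(S)/\mathrm{lr}(S)\le p$. For $A\subseteq M$, $\mathcal{I}|A=\{X\cap A: X\in\mathcal{I}\}$. Round-Robin protocol: $|M|=m$; initially the available set is $Q=M$; for rounds $r=1,\dots,\lceil m/n\rceil$ and within each round for agents $1,\dots,n$ in order, the current agent (by an arbitrary policy possibly using full information) either selects one item of $Q$, which is removed from $Q$, or selects nothing. Greedy policy of agent $i$: maintain $S_i$ (initially $\emptyset$); at each turn let $A=\{x\in Q: S_i\cup\{x\}\in\mathcal{I}_i\}$;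 if $A\neq\emptyset$ select some $j\in\arg\max_{x\in A}f_i(x\,|\,S_i)$ and add it to $S_i$, otherwise select nothing.
   Formalization: The objective $f_i$ takes rational values instead of real ones, and the parameter $p_i$ of the $p_i$-system constraint is rational. -}

module Defs where

open import Data.Bool using (Bool; true; false; _∨_; _∧_)
open import Data.Nat as ℕ using (ℕ; zero; suc)
open import Data.Nat.DivMod using (_/_)
open import Data.Fin as Fin using (Fin; toℕ)
open import Data.Fin.Subset using (Subset; _∈_; _∉_; _⊆_; ⁅_⁆; _∪_; _∩_; _-_; ∣_∣) renaming (⊥ to ∅)
open import Data.Vec using (tabulate)
open import Data.Maybe using (Maybe; just; nothing)
open import Data.Product using (Σ; _×_; ∃; ∃-syntax)
open import Data.Sum using (_⊎_)
open import Data.Integer using (+_)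
open import Data.Rational as ℚ using (ℚ; 0ℚ)
open import Relation.Nullary using (¬_)
open import Relation.Nullary.Decidable using (⌊_⌋)
open import Relation.Binary.PropositionalEquality using (_≡_; _≢_)

SetFun : ℕ → Set
SetFun m = Subset m → ℚ

marg : ∀ {m} → SetFun m → Fin m → Subset m → ℚ
marg f x S = f (S ∪ ⁅ x ⁆) ℚ.- f S

Normalized : ∀ {m} → SetFun m → Set
Normalized f = f ∅ ≡ 0ℚ

NonNegative : ∀ {m} → SetFun m → Set
NonNegative f = ∀ S → 0ℚ ℚ.≤ f S

Monotone : ∀ {m} → SetFun m → Set
Monotone f = ∀ S T → S ⊆ T → f S ℚ.≤ f T

Submodular : ∀ {m} → SetFun m → Set
Submodular f = ∀ S T x → S ⊆ T → x ∉ T → marg f x T ℚ.≤ marg f x S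

Family : ℕ → Set₁
Family m = Subset m → Set

record IndependenceSystem {m} (I : Family m) : Set where
  field
    empty∈  : I ∅
    down    : ∀ X Y → X ⊆ Y → I Y → I X

IsBasis : ∀ {m} → Family m → Subset m → Subset m → Set
IsBasis I S B = B ⊆ S × I B × (∀ B' → B ⊆ B' → B' ⊆ S → I B' → B' ⊆ B)

ℕtoℚ : ℕ → ℚ
ℕtoℚ k = (+ k) ℚ./ 1

-- p-system: max_S ur(S)/lr(S) ≤ p, i.e. for every S and any two bases
-- B₁, B₂ of S, |B₁| ≤ p·|B₂|   (the 0/0 case read as imposing nothing)
IsPSystem : ∀ {m} → Family m → ℚ → Set
IsPSystem I p = IndependenceSystem I ×
  (∀ S B₁ B₂ → IsBasis I S B₁ → IsBasis I S B₂ → ℕtoℚ ∣ B₁ ∣ ℚ.≤ p ℚ.* ℕtoℚ ∣ B₂ ∣)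

Restrict : ∀ {m} → Family m → Subset m → Family m
Restrict I A Y = ∃[ X ] (I X × Y ≡ X ∩ A)

-- number of rounds ⌈ m / n ⌉ (n = number of agents)
rounds : ℕ → ℕ → ℕ
rounds m zero = zero
rounds m (suc k) = (m ℕ.+ k) / suc k

-- A run: in round r, agent a selects  c r a  (an item, or nothing)
Run : (m n : ℕ) → Set
Run m n = Fin (rounds m n) → Fin n → Maybe (Fin m)

Before : ∀ {R n} → Fin R → Fin n → Fin R → Fin n → Set
Before r' a' r a = (toℕ r' ℕ.< toℕ r) ⊎ (r' ≡ r × toℕ a' ℕ.< toℕ a)

Available : ∀ {m n} → Run m n → Fin (rounds m n) → Fin n → Fin m → Set
Available c r a x = ∀ r' a' → Before r' a' r a → c r' a' ≢ just x

ValidRun : ∀ {m n} → Run m n → Set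
ValidRun c = ∀ r a x → c r a ≡ just x → Available c r a x

picked : ∀ {m} → Maybe (Fin m) → Fin m → Bool
picked nothing  x = false
picked (just y) x = ⌊ y Fin.≟ x ⌋

anyFin : ∀ R → (Fin R → Bool) → Bool
anyFin zero    P = false
anyFin (suc R) P = P Fin.zero ∨ anyFin R (λ r → P (Fin.suc r))

selectedBefore : ∀ {m n} → Run m n → Fin n → Fin (rounds m n) → Subset m
selectedBefore {m} {n} c a r = tabulate λ x →
  anyFin (rounds m n) (λ r' → ⌊ toℕ r' ℕ.<? toℕ r ⌋ ∧ picked (c r' a) x)

selected : ∀ {m n} → Run m n → Fin n → Subset m
selected {m} {n} c a = tabulate λ x → anyFin (rounds m n) (λ r → picked (c r a) x)

firstPick : ∀ {m} R → (Fin R → Maybe (Fin m)) → Maybe (Fin m)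
firstPick zero    s = nothing
firstPick (suc R) s with s Fin.zero
... | just x  = just x
... | nothing = firstPick R (λ r → s (Fin.suc r))

removeFirst : ∀ {m n} → Run m n → Fin n → Subset m
removeFirst {m} {n} c j with firstPick (rounds m n) (λ r → c r j)
... | just g  = selected c j - g
... | nothing = selected c j

S′ : ∀ {m n} → Run m n → Fin n → Fin n → Subset m
S′ c i j with toℕ i ℕ.<? toℕ j
... | Relation.Nullary.yes _ = selected c j
... | Relation.Nullary.no  _ = removeFirst c j

GreedyTurn : ∀ {m n} → SetFun m → Family m → Run m n → Fin n → Fin (rounds m n) → Set
GreedyTurn f I c i r =
  let S = selectedBefore c i r
      A = λ x → Available c r i x × I (S ∪ ⁅ x ⁆)
  in (c r i ≡ nothing × (∀ x → ¬ A x))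
     ⊎ (∃[ x ] (c r i ≡ just x × A x × (∀ y → A y → marg f y S ℚ.≤ marg f x S)))

Greedy : ∀ {m n} → SetFun m → Family m → Run m n → Fin n → Set
Greedy f I c i = ∀ r → GreedyTurn f I c i r

{-# OPTIONS --safe #-}
-- Let S t be the items agent i picked before round t. Its gains δ t = f (S (t+1)) − f (S t) do not
-- increase: an item greedily added in a later round was available and addable earlier, and
-- submodularity only lowers its marginal value. Fix an independent O ⊆ S′ c i j, and call o ∈ O
-- dead at round t once j has taken it before i's turn in round t, or once S t ∪ {o} is dependent.
-- Agent j picks at most once per round, and when j moves before i its first pick is excluded from
-- S′, so at most t items die through j; at most p·|S t| die through blocking, because S t is a basis
-- of itself together with the blocked items. An item dying in round t was still available and
-- addable in that round, so its marginal value is at most δ t. Hence the potential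
-- f (S R ∪ D t) + (t + p·|S t| − |D t|)·δ t grows by at most (p+1)·δ t per round, which gives
-- f O ≤ f (S R ∪ D R) ≤ f (S R) + (p+1)·f (S R).
module Submission where

open import Defs
open import Data.Bool using (Bool; true; false; T; T?; _∧_)
open import Data.Bool.Properties using (T-≡; T-∨; T-∧)
open import Data.Empty using (⊥-elim)
open import Data.Nat as ℕ using (ℕ; zero; suc)
import Data.Nat.Properties as ℕP
import Data.Nat.Coprimality as Coprime
open import Data.Nat.Coprimality using (1-coprimeTo)
import Data.Integer as ℤ
import Data.Integer.Properties as ℤP
open import Data.Fin as Fin using (Fin; zero; suc; toℕ; fromℕ<)
import Data.Fin.Properties as FinP
open import Data.Fin.Subset using (Subset; _∈_; _∉_; _⊆_; _∪_; _∩_; _─_; ⁅_⁆; ∣_∣; Nonempty) renaming (⊥ to ∅)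
open import Data.Fin.Subset.Properties
open import Data.Maybe using (Maybe; just; nothing)
open import Data.Maybe.Properties using (just-injective) renaming (≡-dec to ≡-dec-Maybe)
open import Data.Vec using (_∷_; []; tabulate; here; there)
open import Data.Vec.Properties using (lookup∘tabulate; []=⇒lookup; lookup⇒[]=)
open import Data.Rational as ℚ using (ℚ; 0ℚ; 1ℚ; _≤_; _+_; _*_; _-_; mkℚ; *≤*; nonNegative)
open import Data.Rational.Properties
  using ( ≤-refl; ≤-trans; ≤-reflexive; +-mono-≤; +-monoˡ-≤; +-monoʳ-≤; +-inverseʳ; +-identityʳ
        ; *-monoˡ-≤-nonNeg; nonNegative⁻¹; nonNeg*nonNeg⇒nonNeg; normalize-coprime; /-cong; _≤?_
        ; module ≤-Reasoning)
open import Data.Rational.Solver using (module +-*-Solver)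
open import Data.Product using (_×_; _,_; ∃-syntax; proj₁; proj₂)
open import Data.Sum using (_⊎_; inj₁; inj₂)
open import Function using (Equivalence; _∘_; case_of_)
open import Level using (Level)
open import Relation.Nullary using (¬_; Dec; yes; no; ¬?; _×-dec_; _⊎-dec_; contradiction)
open import Relation.Nullary.Decidable using (⌊_⌋; toWitness; fromWitness; decidable-stable; ¬¬-excluded-middle)
open import Relation.Unary using (Pred; Decidable)
open import Relation.Binary.Definitions using (tri<; tri≈; tri>)
open import Relation.Binary.PropositionalEquality

private
  variable
    ℓ : Level
    m N : ℕ

ℕtoℚ≡mkℚ : ∀ k → ℕtoℚ k ≡ mkℚ (ℤ.+ k) 0 (Coprime.sym (1-coprimeTo k))
ℕtoℚ≡mkℚ k = normalize-coprime (Coprime.sym (1-coprimeTo k))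

ℕtoℚ-+ : ∀ a b → ℕtoℚ (a ℕ.+ b) ≡ ℕtoℚ a + ℕtoℚ b
ℕtoℚ-+ a b rewrite ℕtoℚ≡mkℚ a | ℕtoℚ≡mkℚ b =
  /-cong (sym (cong₂ ℤ._+_ (ℤP.*-identityʳ (ℤ.+ a)) (ℤP.*-identityʳ (ℤ.+ b)))) refl

ℕtoℚ-mono : ∀ {a b} → a ℕ.≤ b → ℕtoℚ a ≤ ℕtoℚ b
ℕtoℚ-mono {a} {b} a≤b rewrite ℕtoℚ≡mkℚ a | ℕtoℚ≡mkℚ b =
  *≤* (subst₂ ℤ._≤_ (sym (ℤP.*-identityʳ _)) (sym (ℤP.*-identityʳ _)) (ℤ.+≤+ a≤b))

0≤ℕtoℚ : ∀ k → 0ℚ ≤ ℕtoℚ k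
0≤ℕtoℚ k = ℕtoℚ-mono {0} {k} ℕ.z≤n

ℕtoℚ-suc : ∀ t → ℕtoℚ (suc t) ≡ ℕtoℚ t + 1ℚ
ℕtoℚ-suc t = trans (cong ℕtoℚ (ℕP.+-comm 1 t)) (ℕtoℚ-+ t 1)

gain : (ℕ → ℚ) → ℕ → ℚ
gain F t = F (suc t) - F t

*-monoˡ-≤-nonNeg′ : ∀ {r p q} → 0ℚ ≤ r → p ≤ q → r * p ≤ r * q
*-monoˡ-≤-nonNeg′ {r} 0≤r = *-monoˡ-≤-nonNeg r {{nonNegative 0≤r}}

open +-*-Solver using (solve; _:=_; _:+_; _:*_; _:-_; con)

potential-step : ∀ {p ψ ψ′ a a′ b b′ T δ δ′} →
  ψ′ ≤ ψ + (a′ - a) * δ → 0ℚ ≤ (T + 1ℚ) + p * b′ - a′ → δ′ ≤ δ →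
  b′ ≡ 1ℚ + b ⊎ δ ≡ 0ℚ →
  ψ′ + ((T + 1ℚ) + p * b′ - a′) * δ′ ≤ ψ + (T + p * b - a) * δ + (p + 1ℚ) * δ
potential-step {p} {ψ} {ψ′} {a} {a′} {b} {b′} {T} {δ} {δ′} hψ slack′≥0 δ′≤δ growth = begin
  ψ′ + s′ * δ′                  ≤⟨ +-mono-≤ hψ (*-monoˡ-≤-nonNeg′ slack′≥0 δ′≤δ) ⟩
  ψ + (a′ - a) * δ + s′ * δ     ≡⟨ by-growth growth ⟩
  ψ + (T + p * b - a) * δ + (p + 1ℚ) * δ ∎
  where
  open ≤-Reasoning
  s′ = (T + 1ℚ) + p * b′ - a′
  by-growth : b′ ≡ 1ℚ + b ⊎ δ ≡ 0ℚ → ψ + (a′ - a) * δ + s′ * δ ≡ ψ + (T + p * b - a) * δ + (p + 1ℚ) * δ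
  by-growth (inj₁ refl) = solve 7 (λ p ψ a a′ b T δ →
      ψ :+ (a′ :- a) :* δ :+ ((T :+ con 1ℚ) :+ p :* (con 1ℚ :+ b) :- a′) :* δ
    := ψ :+ (T :+ p :* b :- a) :* δ :+ (p :+ con 1ℚ) :* δ) refl p ψ a a′ b T δ
  by-growth (inj₂ refl) = solve 7 (λ p ψ a a′ b b′ T →
      ψ :+ (a′ :- a) :* con 0ℚ :+ ((T :+ con 1ℚ) :+ p :* b′ :- a′) :* con 0ℚ
    := ψ :+ (T :+ p :* b :- a) :* con 0ℚ :+ (p :+ con 1ℚ) :* con 0ℚ) refl p ψ a a′ b b′ T

p≤q⇒0≤q-p : ∀ {p q} → p ≤ q → 0ℚ ≤ q - p
p≤q⇒0≤q-p {p} p≤q = ≤-trans (≤-reflexive (sym (+-inverseʳ p))) (+-monoˡ-≤ (ℚ.- p) p≤q)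

p≤p+q : ∀ {p q} → 0ℚ ≤ q → p ≤ p + q
p≤p+q {p} 0≤q = ≤-trans (≤-reflexive (sym (+-identityʳ p))) (+-monoʳ-≤ p 0≤q)

0≤p*q : ∀ {p q} → 0ℚ ≤ p → 0ℚ ≤ q → 0ℚ ≤ p * q
0≤p*q {p} {q} 0≤p 0≤q =
  nonNegative⁻¹ (p * q) {{nonNeg*nonNeg⇒nonNeg p {{nonNegative 0≤p}} q {{nonNegative 0≤q}}}}

module Potential (p : ℚ) (ψ a b F : ℕ → ℚ) where

  slack : ℕ → ℚ
  slack t = ℕtoℚ t + p * b t - a t

  Φ : ℕ → ℚ
  Φ t = ψ t + slack t * gain F t

  module _ (R : ℕ)
    (ψ-step : ∀ t → t ℕ.< R → ψ (suc t) ≤ ψ t + (a (suc t) - a t) * gain F t)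
    (a-bound : ∀ t → a t ≤ ℕtoℚ t + p * b t)
    (gain-anti : ∀ t → gain F (suc t) ≤ gain F t)
    (growth : ∀ t → b (suc t) ≡ 1ℚ + b t ⊎ gain F t ≡ 0ℚ)
    where

    Φ-step : ∀ t → t ℕ.< R → Φ (suc t) ≤ Φ t + (p + 1ℚ) * gain F t
    Φ-step t t<R =
      subst (λ T → ψ (suc t) + (T + p * b (suc t) - a (suc t)) * gain F (suc t) ≤ Φ t + (p + 1ℚ) * gain F t)
        (sym (ℕtoℚ-suc t))
        (potential-step {p} {ψ t} {ψ (suc t)} {a t} {a (suc t)} {b t} {b (suc t)} {ℕtoℚ t} (ψ-step t t<R) slack≥0 (gain-anti t) (growth t))
      where
      slack≥0 : 0ℚ ≤ (ℕtoℚ t + 1ℚ) + p * b (suc t) - a (suc t)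
      slack≥0 = subst (λ T → 0ℚ ≤ T + p * b (suc t) - a (suc t)) (ℕtoℚ-suc t) (p≤q⇒0≤q-p (a-bound (suc t)))

    Φ-bound : ∀ t → t ℕ.≤ R → Φ t + (p + 1ℚ) * F 0 ≤ Φ 0 + (p + 1ℚ) * F t
    Φ-bound zero    _   = ≤-refl
    Φ-bound (suc t) t<R = begin
      Φ (suc t) + k * F 0               ≤⟨ +-monoˡ-≤ (k * F 0) (Φ-step t t<R) ⟩
      Φ t + k * gain F t + k * F 0      ≡⟨ solve 4 (λ x k d c → x :+ k :* d :+ k :* c := x :+ k :* c :+ k :* d) refl (Φ t) k (gain F t) (F 0) ⟩
      Φ t + k * F 0 + k * gain F t      ≤⟨ +-monoˡ-≤ (k * gain F t) (Φ-bound t (ℕP.<⇒≤ t<R)) ⟩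
      Φ 0 + k * F t + k * gain F t      ≡⟨ solve 4 (λ y k u v → y :+ k :* u :+ k :* (v :- u) := y :+ k :* v) refl (Φ 0) k (F t) (F (suc t)) ⟩
      Φ 0 + k * F (suc t)               ∎
      where
      open ≤-Reasoning
      k = p + 1ℚ

    potential-bound : a 0 ≡ 0ℚ → b 0 ≡ 0ℚ → 0ℚ ≤ gain F R →
                      ψ R + (p + 1ℚ) * F 0 ≤ ψ 0 + (p + 1ℚ) * F R
    potential-bound a0≡0 b0≡0 0≤gainR = begin
      ψ R + k * F 0   ≤⟨ +-monoˡ-≤ (k * F 0) (p≤p+q {ψ R} (0≤p*q (p≤q⇒0≤q-p (a-bound R)) 0≤gainR)) ⟩
      Φ R + k * F 0   ≤⟨ Φ-bound R ℕP.≤-refl ⟩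
      Φ 0 + k * F R   ≡⟨ cong (λ x → x + k * F R) Φ0≡ψ0 ⟩
      ψ 0 + k * F R   ∎
      where
      open ≤-Reasoning
      k = p + 1ℚ
      Φ0≡ψ0 : Φ 0 ≡ ψ 0
      Φ0≡ψ0 rewrite a0≡0 | b0≡0 = solve 3 (λ p x g → x :+ (con 0ℚ :+ p :* con 0ℚ :- con 0ℚ) :* g := x) refl p (ψ 0) (gain F 0)

∈-tabulate⁺ : ∀ {g : Fin m → Bool} {x} → T (g x) → x ∈ tabulate g
∈-tabulate⁺ {g = g} {x} gx = lookup⇒[]= x (tabulate g) (trans (lookup∘tabulate g x) (Equivalence.to T-≡ gx))

∈-tabulate⁻ : ∀ {g : Fin m → Bool} {x} → x ∈ tabulate g → T (g x)
∈-tabulate⁻ {g = g} {x} x∈ = Equivalence.from T-≡ (trans (sym (lookup∘tabulate g x)) ([]=⇒lookup x∈))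

subsetOf : {P : Pred (Fin m) ℓ} → Decidable P → Subset m
subsetOf P? = tabulate λ x → ⌊ P? x ⌋

module _ {P : Pred (Fin m) ℓ} (P? : Decidable P) where

  ∈-subsetOf⁺ : ∀ {x} → P x → x ∈ subsetOf P?
  ∈-subsetOf⁺ Px = ∈-tabulate⁺ (fromWitness Px)

  ∈-subsetOf⁻ : ∀ {x} → x ∈ subsetOf P? → P x
  ∈-subsetOf⁻ x∈ = toWitness (∈-tabulate⁻ x∈)

¬¬-decidable : ∀ m (P : Subset m → Set ℓ) → ¬ ¬ (∀ X → Dec (P X))
¬¬-decidable zero    P ¬dec = ¬¬-excluded-middle λ P[]? → ¬dec λ { [] → P[]? }
¬¬-decidable (suc m) P ¬dec =
  ¬¬-decidable m (λ X → P (true ∷ X)) λ P-in? →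
  ¬¬-decidable m (λ X → P (false ∷ X)) λ P-out? →
  ¬dec λ { (true ∷ X) → P-in? X ; (false ∷ X) → P-out? X }

x∈p─q⁻ : ∀ (p q : Subset m) {x} → x ∈ p ─ q → x ∈ p × x ∉ q
x∈p─q⁻ (true ∷ p)  (false ∷ q) here = here , λ ()
x∈p─q⁻ (_ ∷ p)     (true ∷ q)  {zero} ()
x∈p─q⁻ (false ∷ p) (false ∷ q) {zero} ()
x∈p─q⁻ (_ ∷ p) (_ ∷ q) (there x∈) with x∈p─q⁻ p q x∈
... | x∈p , x∉q = there x∈p , λ x∈q → x∉q (drop-there x∈q)

∣p∪q∣+∣p∩q∣≡∣p∣+∣q∣ : ∀ (p q : Subset m) → ∣ p ∪ q ∣ ℕ.+ ∣ p ∩ q ∣ ≡ ∣ p ∣ ℕ.+ ∣ q ∣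
∣p∪q∣+∣p∩q∣≡∣p∣+∣q∣ []         []         = refl
∣p∪q∣+∣p∩q∣≡∣p∣+∣q∣ (true ∷ p)  (true ∷ q)  = cong suc (begin
  ∣ p ∪ q ∣ ℕ.+ suc ∣ p ∩ q ∣   ≡⟨ ℕP.+-suc ∣ p ∪ q ∣ ∣ p ∩ q ∣ ⟩
  suc (∣ p ∪ q ∣ ℕ.+ ∣ p ∩ q ∣) ≡⟨ cong suc (∣p∪q∣+∣p∩q∣≡∣p∣+∣q∣ p q) ⟩
  suc (∣ p ∣ ℕ.+ ∣ q ∣)         ≡⟨ ℕP.+-suc ∣ p ∣ ∣ q ∣ ⟨
  ∣ p ∣ ℕ.+ suc ∣ q ∣           ∎)
  where open ≡-Reasoning
∣p∪q∣+∣p∩q∣≡∣p∣+∣q∣ (true ∷ p)  (false ∷ q) = cong suc (∣p∪q∣+∣p∩q∣≡∣p∣+∣q∣ p q)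
∣p∪q∣+∣p∩q∣≡∣p∣+∣q∣ (false ∷ p) (true ∷ q)  =
  trans (cong suc (∣p∪q∣+∣p∩q∣≡∣p∣+∣q∣ p q)) (sym (ℕP.+-suc ∣ p ∣ ∣ q ∣))
∣p∪q∣+∣p∩q∣≡∣p∣+∣q∣ (false ∷ p) (false ∷ q) = ∣p∪q∣+∣p∩q∣≡∣p∣+∣q∣ p q

∣p∪q∣≤∣p∣+∣q∣ : ∀ (p q : Subset m) → ∣ p ∪ q ∣ ℕ.≤ ∣ p ∣ ℕ.+ ∣ q ∣
∣p∪q∣≤∣p∣+∣q∣ p q = subst (∣ p ∪ q ∣ ℕ.≤_) (∣p∪q∣+∣p∩q∣≡∣p∣+∣q∣ p q) (ℕP.m≤m+n _ _)

∣p∪⁅x⁆∣≡1+∣p∣ : ∀ (p : Subset m) {x} → x ∉ p → ∣ p ∪ ⁅ x ⁆ ∣ ≡ suc ∣ p ∣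
∣p∪⁅x⁆∣≡1+∣p∣ {m} p {x} x∉p = begin
  ∣ p ∪ ⁅ x ⁆ ∣                      ≡⟨ ℕP.+-identityʳ _ ⟨
  ∣ p ∪ ⁅ x ⁆ ∣ ℕ.+ 0                ≡⟨ cong (∣ p ∪ ⁅ x ⁆ ∣ ℕ.+_) ∣p∩⁅x⁆∣≡0 ⟨
  ∣ p ∪ ⁅ x ⁆ ∣ ℕ.+ ∣ p ∩ ⁅ x ⁆ ∣    ≡⟨ ∣p∪q∣+∣p∩q∣≡∣p∣+∣q∣ p ⁅ x ⁆ ⟩
  ∣ p ∣ ℕ.+ ∣ ⁅ x ⁆ ∣                ≡⟨ cong (∣ p ∣ ℕ.+_) (∣⁅x⁆∣≡1 x) ⟩
  ∣ p ∣ ℕ.+ 1                        ≡⟨ ℕP.+-comm ∣ p ∣ 1 ⟩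
  suc ∣ p ∣                          ∎
  where
  open ≡-Reasoning
  ∣p∩⁅x⁆∣≡0 : ∣ p ∩ ⁅ x ⁆ ∣ ≡ 0
  ∣p∩⁅x⁆∣≡0 = trans (cong ∣_∣ (Empty-unique disjoint)) (∣⊥∣≡0 m)
    where
    disjoint : ¬ Nonempty (p ∩ ⁅ x ⁆)
    disjoint (y , y∈) with x∈p∩q⁻ p ⁅ x ⁆ y∈
    ... | y∈p , y∈⁅x⁆ = x∉p (subst (_∈ p) (x∈⁅y⁆⇒x≡y _ y∈⁅x⁆) y∈p)

∣p∣+∣q─p∣≡∣q∣ : ∀ {p q : Subset m} → p ⊆ q → ∣ p ∣ ℕ.+ ∣ q ─ p ∣ ≡ ∣ q ∣
∣p∣+∣q─p∣≡∣q∣ {p = []}        {[]}        _   = refl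
∣p∣+∣q─p∣≡∣q∣ {p = true ∷ p}  {true ∷ q}  p⊆q = cong suc (∣p∣+∣q─p∣≡∣q∣ (drop-∷-⊆ p⊆q))
∣p∣+∣q─p∣≡∣q∣ {p = true ∷ p}  {false ∷ q} p⊆q with () ← p⊆q here
∣p∣+∣q─p∣≡∣q∣ {p = false ∷ p} {true ∷ q}  p⊆q =
  trans (ℕP.+-suc ∣ p ∣ ∣ q ─ p ∣) (cong suc (∣p∣+∣q─p∣≡∣q∣ (drop-∷-⊆ p⊆q)))
∣p∣+∣q─p∣≡∣q∣ {p = false ∷ p} {false ∷ q} p⊆q = ∣p∣+∣q─p∣≡∣q∣ (drop-∷-⊆ p⊆q)

x∈p⇒⁅x⁆⊆p : ∀ {p : Subset m} {x} → x ∈ p → ⁅ x ⁆ ⊆ p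
x∈p⇒⁅x⁆⊆p {p = p} x∈p y∈⁅x⁆ = subst (_∈ p) (sym (x∈⁅y⁆⇒x≡y _ y∈⁅x⁆)) x∈p

1+∣p-x∣≡∣p∣ : ∀ {p : Subset m} {x} → x ∈ p → suc ∣ p ─ ⁅ x ⁆ ∣ ≡ ∣ p ∣
1+∣p-x∣≡∣p∣ {p = p} {x} x∈p =
  trans (cong (ℕ._+ ∣ p ─ ⁅ x ⁆ ∣) (sym (∣⁅x⁆∣≡1 x))) (∣p∣+∣q─p∣≡∣q∣ (x∈p⇒⁅x⁆⊆p x∈p))

∪-least : ∀ {p q r : Subset m} → p ⊆ r → q ⊆ r → p ∪ q ⊆ r
∪-least {p = p} {q} p⊆r q⊆r y∈ with x∈p∪q⁻ p q y∈
... | inj₁ y∈p = p⊆r y∈p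
... | inj₂ y∈q = q⊆r y∈q

p∪⁅x⁆⊆p : ∀ {p : Subset m} {x} → x ∈ p → p ∪ ⁅ x ⁆ ⊆ p
p∪⁅x⁆⊆p x∈p = ∪-least (λ y∈p → y∈p) (x∈p⇒⁅x⁆⊆p x∈p)

p∪q⊆[p∪q─⁅x⁆]∪⁅x⁆ : ∀ (p q : Subset m) {x} → x ∈ q → p ∪ q ⊆ (p ∪ (q ─ ⁅ x ⁆)) ∪ ⁅ x ⁆
p∪q⊆[p∪q─⁅x⁆]∪⁅x⁆ p q {x} x∈q = ∪-least (p⊆p∪q ⁅ x ⁆ ∘ p⊆p∪q (q ─ ⁅ x ⁆)) from-q
  where
  from-q : q ⊆ (p ∪ (q ─ ⁅ x ⁆)) ∪ ⁅ x ⁆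
  from-q {y} y∈q with y Fin.≟ x
  ... | yes refl = q⊆p∪q (p ∪ (q ─ ⁅ x ⁆)) ⁅ x ⁆ (x∈⁅x⁆ x)
  ... | no y≢x   = p⊆p∪q ⁅ x ⁆ (q⊆p∪q p (q ─ ⁅ x ⁆) (x∈p∧x≢y⇒x∈p-y y∈q y≢x))

r∪q⊆[r∪p]∪[q─p] : ∀ (r p q : Subset m) → r ∪ q ⊆ (r ∪ p) ∪ (q ─ p)
r∪q⊆[r∪p]∪[q─p] r p q = ∪-least (p⊆p∪q (q ─ p) ∘ p⊆p∪q p) from-q
  where
  from-q : q ⊆ (r ∪ p) ∪ (q ─ p)
  from-q {y} y∈q with y ∈? p
  ... | yes y∈p = p⊆p∪q (q ─ p) (q⊆p∪q r p y∈p)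
  ... | no  y∉p = q⊆p∪q (r ∪ p) (q ─ p) (x∈p∧x∉q⇒x∈p─q y∈q y∉p)

module _ (f : SetFun m) (monotone : Monotone f) (submodular : Submodular f) where

  f[X∪⁅x⁆]≤f[X]+θ : ∀ X x {θ} → 0ℚ ≤ θ → (x ∉ X → marg f x X ≤ θ) → f (X ∪ ⁅ x ⁆) ≤ f X + θ
  f[X∪⁅x⁆]≤f[X]+θ X x 0≤θ bound with x ∈? X
  ... | yes x∈X = ≤-trans (monotone _ _ (p∪⁅x⁆⊆p x∈X)) (p≤p+q 0≤θ)
  ... | no  x∉X = begin
    f (X ∪ ⁅ x ⁆)     ≡⟨ solve 2 (λ a b → b := a :+ (b :- a)) refl (f X) (f (X ∪ ⁅ x ⁆)) ⟩
    f X + marg f x X  ≤⟨ +-monoʳ-≤ (f X) (bound x∉X) ⟩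
    f X + _           ∎
    where
    open ≤-Reasoning

  f[X∪D]≤f[X]+∣D∣θ : ∀ X D {θ} → 0ℚ ≤ θ → (∀ o → o ∈ D → o ∉ X → marg f o X ≤ θ) →
          f (X ∪ D) ≤ f X + ℕtoℚ ∣ D ∣ * θ
  f[X∪D]≤f[X]+∣D∣θ X D {θ} 0≤θ bound = go ∣ D ∣ D (λ o∈ → o∈) refl
    where
    go : ∀ k D′ → D′ ⊆ D → ∣ D′ ∣ ≡ k → f (X ∪ D′) ≤ f X + ℕtoℚ k * θ
    go k D′ D′⊆D ∣D′∣≡k with nonempty? D′
    go k       D′ D′⊆D ∣D′∣≡k | no empty =
      ≤-trans (monotone _ _ (∪-least (λ y∈ → y∈) λ y∈ → contradiction (_ , y∈) empty))
              (p≤p+q (0≤p*q (0≤ℕtoℚ k) 0≤θ))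
    go zero    D′ D′⊆D ∣D′∣≡0 | yes (x , x∈D′) =
      contradiction (subst (λ n → ∣ D′ ─ ⁅ x ⁆ ∣ ℕ.< n) ∣D′∣≡0 (x∈p⇒∣p-x∣<∣p∣ x∈D′)) ℕP.n≮0
    go (suc k) D′ D′⊆D ∣D′∣≡1+k | yes (x , x∈D′) = begin
      f (X ∪ D′)                      ≤⟨ monotone _ _ (p∪q⊆[p∪q─⁅x⁆]∪⁅x⁆ X D′ x∈D′) ⟩
      f ((X ∪ (D′ ─ ⁅ x ⁆)) ∪ ⁅ x ⁆)  ≤⟨ f[X∪⁅x⁆]≤f[X]+θ (X ∪ (D′ ─ ⁅ x ⁆)) x 0≤θ marginal ⟩
      f (X ∪ (D′ ─ ⁅ x ⁆)) + θ        ≤⟨ +-monoˡ-≤ θ (go k (D′ ─ ⁅ x ⁆) (D′⊆D ∘ p─q⊆p D′ ⁅ x ⁆) ∣D′─⁅x⁆∣≡k) ⟩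
      f X + ℕtoℚ k * θ + θ            ≡⟨ solve 3 (λ a c t → a :+ c :* t :+ t := a :+ (c :+ con 1ℚ) :* t) refl (f X) (ℕtoℚ k) θ ⟩
      f X + (ℕtoℚ k + 1ℚ) * θ         ≡⟨ cong (λ c → f X + c * θ) (ℕtoℚ-suc k) ⟨
      f X + ℕtoℚ (suc k) * θ          ∎
      where
      open ≤-Reasoning
      ∣D′─⁅x⁆∣≡k : ∣ D′ ─ ⁅ x ⁆ ∣ ≡ k
      ∣D′─⁅x⁆∣≡k = ℕP.suc-injective (trans (1+∣p-x∣≡∣p∣ x∈D′) ∣D′∣≡1+k)
      marginal : x ∉ X ∪ (D′ ─ ⁅ x ⁆) → marg f x (X ∪ (D′ ─ ⁅ x ⁆)) ≤ θ
      marginal x∉ = ≤-trans (submodular X (X ∪ (D′ ─ ⁅ x ⁆)) x (p⊆p∪q _) x∉)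
                            (bound x (D′⊆D x∈D′) (x∉ ∘ p⊆p∪q (D′ ─ ⁅ x ⁆)))

record ChargingScheme (f : SetFun m) (p : ℚ) (R : ℕ) (S D : ℕ → Subset m) : Set where
  field
    S-zero    : S 0 ≡ ∅
    S-step    : ∀ t → S t ⊆ S (suc t)
    S⊆S-final : ∀ t → S t ⊆ S R
    gain-anti : ∀ t → gain (f ∘ S) (suc t) ≤ gain (f ∘ S) t
    growth    : ∀ t → ∣ S (suc t) ∣ ≡ suc ∣ S t ∣ ⊎ gain (f ∘ S) t ≡ 0ℚ
    D-zero    : D 0 ≡ ∅
    D-step    : ∀ t → D t ⊆ D (suc t)
    D-card    : ∀ t → ℕtoℚ ∣ D t ∣ ≤ ℕtoℚ t + p * ℕtoℚ ∣ S t ∣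
    D-charge  : ∀ t → t ℕ.< R → ∀ o → o ∈ D (suc t) → o ∉ D t → marg f o (S t) ≤ gain (f ∘ S) t

module _ {f : SetFun m} (normalized : Normalized f) (monotone : Monotone f) (submodular : Submodular f)
         {p R S D} (scheme : ChargingScheme f p R S D) where

  open ChargingScheme scheme

  private
    ψ : ℕ → ℚ
    ψ t = f (S R ∪ D t)

    δ : ℕ → ℚ
    δ = gain (f ∘ S)

  0≤gain : ∀ t → 0ℚ ≤ δ t
  0≤gain t = p≤q⇒0≤q-p (monotone _ _ (S-step t))

  ψ-step : ∀ t → t ℕ.< R → ψ (suc t) ≤ ψ t + (ℕtoℚ ∣ D (suc t) ∣ - ℕtoℚ ∣ D t ∣) * δ t
  ψ-step t t<R = begin
    f (S R ∪ D (suc t))                        ≤⟨ monotone _ _ (r∪q⊆[r∪p]∪[q─p] (S R) (D t) (D (suc t))) ⟩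
    f ((S R ∪ D t) ∪ new)                      ≤⟨ f[X∪D]≤f[X]+∣D∣θ f monotone submodular (S R ∪ D t) new (0≤gain t) charge ⟩
    f (S R ∪ D t) + ℕtoℚ ∣ new ∣ * δ t         ≡⟨ cong (λ x → ψ t + x * δ t) ∣new∣≡ ⟩
    ψ t + (ℕtoℚ ∣ D (suc t) ∣ - ℕtoℚ ∣ D t ∣) * δ t ∎
    where
    open ≤-Reasoning
    new = D (suc t) ─ D t
    charge : ∀ o → o ∈ new → o ∉ S R ∪ D t → marg f o (S R ∪ D t) ≤ δ t
    charge o o∈new o∉ with x∈p─q⁻ (D (suc t)) (D t) o∈new
    ... | o∈D′ , o∉D = ≤-trans (submodular (S t) (S R ∪ D t) o (p⊆p∪q (D t) ∘ S⊆S-final t) o∉)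
                               (D-charge t t<R o o∈D′ o∉D)
    ∣new∣≡ : ℕtoℚ ∣ new ∣ ≡ ℕtoℚ ∣ D (suc t) ∣ - ℕtoℚ ∣ D t ∣
    ∣new∣≡ = begin-equality
      ℕtoℚ ∣ new ∣                                  ≡⟨ solve 2 (λ a n → n := a :+ n :- a) refl (ℕtoℚ ∣ D t ∣) (ℕtoℚ ∣ new ∣) ⟩
      ℕtoℚ ∣ D t ∣ + ℕtoℚ ∣ new ∣ - ℕtoℚ ∣ D t ∣    ≡⟨ cong (_- ℕtoℚ ∣ D t ∣) (ℕtoℚ-+ ∣ D t ∣ ∣ new ∣) ⟨
      ℕtoℚ (∣ D t ∣ ℕ.+ ∣ new ∣) - ℕtoℚ ∣ D t ∣     ≡⟨ cong (λ k → ℕtoℚ k - ℕtoℚ ∣ D t ∣) (∣p∣+∣q─p∣≡∣q∣ (D-step t)) ⟩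
      ℕtoℚ ∣ D (suc t) ∣ - ℕtoℚ ∣ D t ∣             ∎

  charging-bound : f (S R ∪ D R) ≤ (p + ℕtoℚ 2) * f (S R)
  charging-bound = begin
    ψ R                                 ≡⟨ solve 2 (λ x k → x := x :+ k :* con 0ℚ) refl (ψ R) (p + 1ℚ) ⟩
    ψ R + (p + 1ℚ) * 0ℚ                 ≡⟨ cong (λ y → ψ R + (p + 1ℚ) * y) (trans (cong f S-zero) normalized) ⟨
    ψ R + (p + 1ℚ) * f (S 0)            ≤⟨ potential-bound R ψ-step D-card gain-anti growth′ (∣X∣≡0 D-zero) (∣X∣≡0 S-zero) (0≤gain R) ⟩
    ψ 0 + (p + 1ℚ) * f (S R)            ≡⟨ cong (λ X → f X + (p + 1ℚ) * f (S R)) (trans (cong (S R ∪_) D-zero) (∪-identityʳ (S R))) ⟩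
    f (S R) + (p + 1ℚ) * f (S R)        ≡⟨ solve 2 (λ p y → y :+ (p :+ con 1ℚ) :* y := (p :+ (con 1ℚ :+ con 1ℚ)) :* y) refl p (f (S R)) ⟩
    (p + ℕtoℚ 2) * f (S R)              ∎
    where
    open ≤-Reasoning
    open Potential p ψ (λ t → ℕtoℚ ∣ D t ∣) (λ t → ℕtoℚ ∣ S t ∣) (f ∘ S)
    growth′ : ∀ t → ℕtoℚ ∣ S (suc t) ∣ ≡ 1ℚ + ℕtoℚ ∣ S t ∣ ⊎ δ t ≡ 0ℚ
    growth′ t with growth t
    ... | inj₁ ∣S′∣≡ = inj₁ (trans (cong ℕtoℚ ∣S′∣≡) (ℕtoℚ-+ 1 ∣ S t ∣))
    ... | inj₂ δ≡0   = inj₂ δ≡0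
    ∣X∣≡0 : ∀ {X : Subset m} → X ≡ ∅ → ℕtoℚ ∣ X ∣ ≡ 0ℚ
    ∣X∣≡0 refl = cong ℕtoℚ (∣⊥∣≡0 m)

module _ {I : Family m} (indep : IndependenceSystem I) where

  open IndependenceSystem indep

  extend-to-basis : (∀ X → Dec (I X)) → ∀ U {K} → K ⊆ U → I K → ∃[ B ] (K ⊆ B × IsBasis I U B)
  extend-to-basis I? U {K} K⊆U IK = go m K (ℕP.m≤n+m m ∣ K ∣) (λ k∈ → k∈) K⊆U IK
    where
    go : ∀ fuel B → m ℕ.≤ ∣ B ∣ ℕ.+ fuel → K ⊆ B → B ⊆ U → I B → ∃[ B′ ] (K ⊆ B′ × IsBasis I U B′)
    go fuel B enough K⊆B B⊆U IB with FinP.any? (λ x → x ∈? U ×-dec ¬? (x ∈? B) ×-dec I? (B ∪ ⁅ x ⁆))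
    ... | no ¬extensible = B , K⊆B , B⊆U , IB , maximal
      where
      maximal : ∀ B′ → B ⊆ B′ → B′ ⊆ U → I B′ → B′ ⊆ B
      maximal B′ B⊆B′ B′⊆U IB′ {y} y∈B′ with y ∈? B
      ... | yes y∈B = y∈B
      ... | no  y∉B = contradiction (y , B′⊆U y∈B′ , y∉B , down _ _ (∪-least B⊆B′ (x∈p⇒⁅x⁆⊆p y∈B′)) IB′) ¬extensible
    ... | yes (x , x∈U , x∉B , IB∪x) with fuel
    ...   | zero = contradiction (subst (m ℕ.≤_) (ℕP.+-identityʳ ∣ B ∣) enough) (ℕP.<⇒≱ ∣B∣<m)
      where
      ∣B∣<m : ∣ B ∣ ℕ.< m
      ∣B∣<m = subst (ℕ._≤ m) (∣p∪⁅x⁆∣≡1+∣p∣ B x∉B) (∣p∣≤n (B ∪ ⁅ x ⁆))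
    ...   | suc fuel = go fuel (B ∪ ⁅ x ⁆) enough′ (p⊆p∪q _ ∘ K⊆B) (∪-least B⊆U (x∈p⇒⁅x⁆⊆p x∈U)) IB∪x
      where
      enough′ : m ℕ.≤ ∣ B ∪ ⁅ x ⁆ ∣ ℕ.+ fuel
      enough′ = subst (m ℕ.≤_) (trans (ℕP.+-suc ∣ B ∣ fuel) (cong (ℕ._+ fuel) (sym (∣p∪⁅x⁆∣≡1+∣p∣ B x∉B)))) enough

  basis-of-blocked : ∀ {S K} → I S → (∀ k → k ∈ K → ¬ I (S ∪ ⁅ k ⁆)) → IsBasis I (S ∪ K) S
  basis-of-blocked {S} {K} IS blocked = p⊆p∪q K , IS , maximal
    where
    maximal : ∀ B′ → S ⊆ B′ → B′ ⊆ S ∪ K → I B′ → B′ ⊆ S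
    maximal B′ S⊆B′ B′⊆S∪K IB′ {y} y∈B′ with x∈p∪q⁻ S K (B′⊆S∪K y∈B′)
    ... | inj₁ y∈S = y∈S
    ... | inj₂ y∈K = contradiction (down _ _ (∪-least S⊆B′ (x∈p⇒⁅x⁆⊆p y∈B′)) IB′) (blocked y y∈K)

blocked-card : ∀ {I : Family m} {p S K} → IsPSystem I p → (∀ X → Dec (I X)) →
               I S → I K → (∀ k → k ∈ K → ¬ I (S ∪ ⁅ k ⁆)) → ℕtoℚ ∣ K ∣ ≤ p * ℕtoℚ ∣ S ∣
blocked-card {S = S} {K} (indep , ratio) I? IS IK blocked with extend-to-basis indep I? (S ∪ K) (q⊆p∪q S K) IK
... | B , K⊆B , B-basis =
  ≤-trans (ℕtoℚ-mono (p⊆q⇒∣p∣≤∣q∣ K⊆B)) (ratio (S ∪ K) B S B-basis (basis-of-blocked indep IS blocked))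

T-anyFin⁺ : ∀ {P : Fin N → Bool} r → T (P r) → T (anyFin N P)
T-anyFin⁺ {P = P} zero    Pr = Equivalence.from T-∨ (inj₁ Pr)
T-anyFin⁺ {P = P} (suc r) Pr = Equivalence.from (T-∨ {P zero}) (inj₂ (T-anyFin⁺ r Pr))

T-anyFin⁻ : ∀ {P : Fin N → Bool} → T (anyFin N P) → ∃[ r ] T (P r)
T-anyFin⁻ {N = suc N} {P} any with Equivalence.to (T-∨ {P zero}) any
... | inj₁ P0  = zero , P0
... | inj₂ any′ with T-anyFin⁻ any′
...   | r , Pr = suc r , Pr

T-picked⁺ : ∀ (x : Fin m) → T (picked (just x) x)
T-picked⁺ x = fromWitness {a? = x Fin.≟ x} refl

T-picked⁻ : ∀ (o : Maybe (Fin m)) {x} → T (picked o x) → o ≡ just x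
T-picked⁻ (just y) {x} y≡x = cong just (toWitness {a? = y Fin.≟ x} y≡x)

picks : (Fin N → Maybe (Fin m)) → (Fin N → Bool) → Subset m
picks {N = N} s b = tabulate λ x → anyFin N λ r → b r ∧ picked (s r) x

module _ (s : Fin N → Maybe (Fin m)) (b : Fin N → Bool) where

  ∈-picks⁺ : ∀ r {x} → T (b r) → s r ≡ just x → x ∈ picks s b
  ∈-picks⁺ r {x} br sr = ∈-tabulate⁺ (T-anyFin⁺ r (Equivalence.from T-∧ (br , picked-x)))
    where
    picked-x : T (picked (s r) x)
    picked-x rewrite sr = T-picked⁺ x

  ∈-picks⁻ : ∀ {x} → x ∈ picks s b → ∃[ r ] (T (b r) × s r ≡ just x)
  ∈-picks⁻ x∈ with T-anyFin⁻ (∈-tabulate⁻ x∈)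
  ... | r , br∧pr with Equivalence.to T-∧ br∧pr
  ...   | br , pr = r , br , T-picked⁻ (s r) pr

⁅_⁆ᵐ : Maybe (Fin m) → Subset m
⁅ just x ⁆ᵐ = ⁅ x ⁆
⁅ nothing ⁆ᵐ = ∅

∈⁅o⁆ᵐ⁻ : ∀ (o : Maybe (Fin m)) {x} → x ∈ ⁅ o ⁆ᵐ → o ≡ just x
∈⁅o⁆ᵐ⁻ (just y) x∈ = cong just (sym (x∈⁅y⁆⇒x≡y _ x∈))
∈⁅o⁆ᵐ⁻ nothing  x∈ = contradiction x∈ ∉⊥

∣⁅o⁆ᵐ∣≤1 : ∀ (o : Maybe (Fin m)) → ∣ ⁅ o ⁆ᵐ ∣ ℕ.≤ 1
∣⁅o⁆ᵐ∣≤1 (just x) = ℕP.≤-reflexive (∣⁅x⁆∣≡1 x)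
∣⁅o⁆ᵐ∣≤1 {m} nothing = ℕP.≤-trans (ℕP.≤-reflexive (∣⊥∣≡0 m)) ℕ.z≤n

∣picks∣≤width : ∀ (s : Fin N → Maybe (Fin m)) b l k →
                (∀ r → T (b r) → l ℕ.≤ toℕ r × toℕ r ℕ.< l ℕ.+ k) → ∣ picks s b ∣ ℕ.≤ k
∣picks∣≤width {N = zero} {m = m} s b l k _ =
  ℕP.≤-trans (p⊆q⇒∣p∣≤∣q∣ {p = picks s b} {q = ∅} λ x∈ → case ∈-picks⁻ s b x∈ of λ { (() , _) })
             (ℕP.≤-trans (ℕP.≤-reflexive (∣⊥∣≡0 m)) ℕ.z≤n)
∣picks∣≤width {N = suc N} s b l k window with T? (b zero)
... | no ¬b0 = ℕP.≤-trans (p⊆q⇒∣p∣≤∣q∣ later) (∣picks∣≤width (s ∘ suc) (b ∘ suc) (ℕ.pred l) k shifted)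
  where
  later : picks s b ⊆ picks (s ∘ suc) (b ∘ suc)
  later x∈ with ∈-picks⁻ s b x∈
  ... | zero  , b0 , _  = contradiction b0 ¬b0
  ... | suc r , br , sr = ∈-picks⁺ (s ∘ suc) (b ∘ suc) r br sr
  shifted : ∀ r → T (b (suc r)) → ℕ.pred l ℕ.≤ toℕ r × toℕ r ℕ.< ℕ.pred l ℕ.+ k
  shifted r br with window (suc r) br
  ... | l≤1+r , 1+r<l+k = ℕP.pred-mono-≤ l≤1+r , pred-window l 1+r<l+k
    where
    pred-window : ∀ l → suc (toℕ r) ℕ.< l ℕ.+ k → toℕ r ℕ.< ℕ.pred l ℕ.+ k
    pred-window zero    = ℕP.<-trans (ℕP.n<1+n (toℕ r))
    pred-window (suc l) = ℕP.≤-pred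
... | yes b0 with window zero b0
...   | ℕ.z≤n , ℕ.s≤s {n = k′} _ = begin
  ∣ picks s b ∣                                      ≤⟨ p⊆q⇒∣p∣≤∣q∣ first∪later ⟩
  ∣ ⁅ s zero ⁆ᵐ ∪ picks (s ∘ suc) (b ∘ suc) ∣        ≤⟨ ∣p∪q∣≤∣p∣+∣q∣ ⁅ s zero ⁆ᵐ _ ⟩
  ∣ ⁅ s zero ⁆ᵐ ∣ ℕ.+ ∣ picks (s ∘ suc) (b ∘ suc) ∣  ≤⟨ ℕP.+-mono-≤ (∣⁅o⁆ᵐ∣≤1 (s zero)) (∣picks∣≤width (s ∘ suc) (b ∘ suc) 0 k′ shifted) ⟩
  suc k′                                             ∎
  where
  open ℕP.≤-Reasoning
  first∪later : picks s b ⊆ ⁅ s zero ⁆ᵐ ∪ picks (s ∘ suc) (b ∘ suc)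
  first∪later {x} x∈ with ∈-picks⁻ s b x∈
  ... | zero  , _  , s0 = p⊆p∪q _ (subst (λ o → x ∈ ⁅ o ⁆ᵐ) (sym s0) (x∈⁅x⁆ x))
  ... | suc r , br , sr = q⊆p∪q ⁅ s zero ⁆ᵐ _ (∈-picks⁺ (s ∘ suc) (b ∘ suc) r br sr)
  shifted : ∀ r → T (b (suc r)) → 0 ℕ.≤ toℕ r × toℕ r ℕ.< k′
  shifted r br = ℕ.z≤n , ℕP.≤-pred (proj₂ (window (suc r) br))

module _ {m n} (c : Run m n) where

  pickedBefore : Fin n → ℕ → Subset m
  pickedBefore a t = picks (λ r → c r a) (λ r → ⌊ toℕ r ℕ.<? t ⌋)

  ∈-selected⁺ : ∀ {a r x} → c r a ≡ just x → x ∈ selected c a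
  ∈-selected⁺ {a} {r} = ∈-picks⁺ (λ r → c r a) _ r _

  ∈-selected⁻ : ∀ {a x} → x ∈ selected c a → ∃[ r ] c r a ≡ just x
  ∈-selected⁻ {a} x∈ with ∈-picks⁻ (λ r → c r a) _ x∈
  ... | r , _ , cr = r , cr

  ∈-pickedBefore⁺ : ∀ {a t x} r → toℕ r ℕ.< t → c r a ≡ just x → x ∈ pickedBefore a t
  ∈-pickedBefore⁺ {a} r r<t = ∈-picks⁺ (λ r → c r a) _ r (fromWitness r<t)

  ∈-pickedBefore⁻ : ∀ {a t x} → x ∈ pickedBefore a t → ∃[ r ] (toℕ r ℕ.< t × c r a ≡ just x)
  ∈-pickedBefore⁻ {a} x∈ with ∈-picks⁻ (λ r → c r a) _ x∈
  ... | r , r<t , cr = r , toWitness r<t , cr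

  pickedBefore⊆selected : ∀ {a t} → pickedBefore a t ⊆ selected c a
  pickedBefore⊆selected x∈ with ∈-pickedBefore⁻ x∈
  ... | _ , _ , cr = ∈-selected⁺ cr

  pickedBefore-mono : ∀ {a t t′} → t ℕ.≤ t′ → pickedBefore a t ⊆ pickedBefore a t′
  pickedBefore-mono t≤t′ x∈ with ∈-pickedBefore⁻ x∈
  ... | r , r<t , cr = ∈-pickedBefore⁺ r (ℕP.<-≤-trans r<t t≤t′) cr

  pickedBefore-zero : ∀ {a} → pickedBefore a 0 ≡ ∅
  pickedBefore-zero {a} = Empty-unique λ { (_ , x∈) → case ∈-pickedBefore⁻ {a} {0} x∈ of λ { (_ , () , _) } }

  pickedBefore-all : ∀ {a t} → rounds m n ℕ.≤ t → pickedBefore a t ≡ selected c a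
  pickedBefore-all R≤t = ⊆-antisym pickedBefore⊆selected λ x∈ →
    let (r , cr) = ∈-selected⁻ x∈ in ∈-pickedBefore⁺ r (ℕP.<-≤-trans (FinP.toℕ<n r) R≤t) cr

  pickedBefore-suc : ∀ {a} r → pickedBefore a (suc (toℕ r)) ≡ pickedBefore a (toℕ r) ∪ ⁅ c r a ⁆ᵐ
  pickedBefore-suc {a} r = ⊆-antisym split (∪-least (pickedBefore-mono (ℕP.n≤1+n _)) this-round)
    where
    split : pickedBefore a (suc (toℕ r)) ⊆ pickedBefore a (toℕ r) ∪ ⁅ c r a ⁆ᵐ
    split {x} x∈ with ∈-pickedBefore⁻ x∈
    ... | r′ , r′<1+r , cr′ with ℕP.m≤n⇒m<n∨m≡n (ℕP.≤-pred r′<1+r)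
    ...   | inj₁ r′<r = p⊆p∪q _ (∈-pickedBefore⁺ r′ r′<r cr′)
    ...   | inj₂ r′≡r rewrite FinP.toℕ-injective r′≡r = q⊆p∪q _ ⁅ c r a ⁆ᵐ (subst (λ o → x ∈ ⁅ o ⁆ᵐ) (sym cr′) (x∈⁅x⁆ x))
    this-round : ⁅ c r a ⁆ᵐ ⊆ pickedBefore a (suc (toℕ r))
    this-round x∈ = ∈-pickedBefore⁺ r (ℕP.n<1+n _) (∈⁅o⁆ᵐ⁻ (c r a) x∈)

module _ {R n : ℕ} where

  Before-trans : ∀ {r₁ r₂ r₃ : Fin R} {a₁ a₂ a₃ : Fin n} →
                 Before r₁ a₁ r₂ a₂ → Before r₂ a₂ r₃ a₃ → Before r₁ a₁ r₃ a₃
  Before-trans (inj₁ r₁<r₂)         (inj₁ r₂<r₃)         = inj₁ (ℕP.<-trans r₁<r₂ r₂<r₃)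
  Before-trans (inj₁ r₁<r₂)         (inj₂ (refl , _))    = inj₁ r₁<r₂
  Before-trans (inj₂ (refl , _))    (inj₁ r₂<r₃)         = inj₁ r₂<r₃
  Before-trans (inj₂ (refl , a₁<a₂)) (inj₂ (refl , a₂<a₃)) = inj₂ (refl , ℕP.<-trans a₁<a₂ a₂<a₃)

  Before-connex : ∀ {r r′ : Fin R} {a b : Fin n} → a ≢ b → ¬ Before r a r′ b → Before r′ b r a
  Before-connex {r} {r′} {a} {b} a≢b ¬before with ℕ.<-cmp (toℕ r) (toℕ r′)
  ... | tri< r<r′ _ _ = contradiction (inj₁ r<r′) ¬before
  ... | tri> _ _ r′<r = inj₁ r′<r
  ... | tri≈ _ r≡r′ _ with FinP.toℕ-injective r≡r′ | ℕ.<-cmp (toℕ a) (toℕ b)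
  ...   | refl | tri< a<b _ _ = contradiction (inj₂ (refl , a<b)) ¬before
  ...   | refl | tri≈ _ a≡b _ = contradiction (FinP.toℕ-injective a≡b) a≢b
  ...   | refl | tri> _ _ b<a = inj₂ (refl , b<a)

Available-anti : ∀ {m n} {c : Run m n} {r r′ a a′ x} →
                 Before r a r′ a′ → Available c r′ a′ x → Available c r a x
Available-anti before avail r″ a″ before″ = avail r″ a″ (Before-trans before″ before)

module _ {m n} {c : Run m n} (valid : ValidRun c) where

  pick-unique : ∀ {a u u′ x} → c u a ≡ just x → c u′ a ≡ just x → u ≡ u′
  pick-unique {a} {u} {u′} {x} cu cu′ with FinP.<-cmp u u′
  ... | tri< u<u′ _ _ = contradiction cu (valid u′ a x cu′ u a (inj₁ u<u′))
  ... | tri≈ _ u≡u′ _ = u≡u′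
  ... | tri> _ _ u′<u = contradiction cu′ (valid u a x cu u′ a (inj₁ u′<u))

  available-unless-picked-before : ∀ {u r a b x} → c u a ≡ just x → a ≢ b → ¬ Before u a r b →
                                   Available c r b x
  available-unless-picked-before {u} {a = a} {x = x} cu a≢b ¬before =
    Available-anti (Before-connex a≢b ¬before) (valid u a x cu)

round-or-after : ∀ {ℓ R} (P : ℕ → Set ℓ) → (∀ (r : Fin R) → P (toℕ r)) → (∀ t → R ℕ.≤ t → P t) → ∀ t → P t
round-or-after {R = R} P at-round after t with t ℕ.<? R
... | yes t<R = subst P (FinP.toℕ-fromℕ< t<R) (at-round (fromℕ< t<R))
... | no  t≮R = after t (ℕP.≮⇒≥ t≮R)

module GreedyAgent {m n} {f : SetFun m} {I : Family m}
  (monotone : Monotone f) (submodular : Submodular f) (indep : IndependenceSystem I)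
  {c : Run m n} {i : Fin n} (greedy : Greedy f I c i) where

  open IndependenceSystem indep

  R : ℕ
  R = rounds m n

  S : ℕ → Subset m
  S = pickedBefore c i

  δ : ℕ → ℚ
  δ = gain (f ∘ S)

  0≤δ : ∀ t → 0ℚ ≤ δ t
  0≤δ t = p≤q⇒0≤q-p (monotone _ _ (pickedBefore-mono c (ℕP.n≤1+n t)))

  S-after : ∀ {t} → R ℕ.≤ t → S (suc t) ≡ S t
  S-after R≤t = trans (pickedBefore-all c (ℕP.m≤n⇒m≤1+n R≤t)) (sym (pickedBefore-all c R≤t))

  δ≡0 : ∀ {t} → S (suc t) ≡ S t → δ t ≡ 0ℚ
  δ≡0 {t} S′≡S = trans (cong (λ X → f X - f (S t)) S′≡S) (+-inverseʳ (f (S t)))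

  S-round : ∀ {r x} → c r i ≡ just x → S (suc (toℕ r)) ≡ S (toℕ r) ∪ ⁅ x ⁆
  S-round {r} cr = trans (pickedBefore-suc c r) (cong (λ o → S (toℕ r) ∪ ⁅ o ⁆ᵐ) cr)

  δ-round : ∀ {r x} → c r i ≡ just x → δ (toℕ r) ≡ marg f x (S (toℕ r))
  δ-round {r} cr = cong (λ X → f X - f (S (toℕ r))) (S-round cr)

  S-round-idle : ∀ {r} → c r i ≡ nothing → S (suc (toℕ r)) ≡ S (toℕ r)
  S-round-idle {r} cr = trans (pickedBefore-suc c r) (trans (cong (λ o → S (toℕ r) ∪ ⁅ o ⁆ᵐ) cr) (∪-identityʳ _))

  available⇒∉S : ∀ {r x} → Available c r i x → x ∉ S (toℕ r)
  available⇒∉S {r} avail x∈ with ∈-pickedBefore⁻ c {i} {toℕ r} x∈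
  ... | r′ , r′<r , cr′ = avail r′ i (inj₁ r′<r) cr′

  greedy-bound : ∀ r {x} → Available c r i x → I (S (toℕ r) ∪ ⁅ x ⁆) → marg f x (S (toℕ r)) ≤ δ (toℕ r)
  greedy-bound r {x} avail Ix with greedy r
  ... | inj₁ (_ , nothing-addable)      = ⊥-elim (nothing-addable x (avail , Ix))
  ... | inj₂ (y , cr , _ , y-maximizes) = ≤-trans (y-maximizes x (avail , Ix)) (≤-reflexive (sym (δ-round cr)))

  I-S : ∀ t → I (S t)
  I-S zero    = subst I (sym (pickedBefore-zero c {i})) empty∈
  I-S (suc t) = round-or-after (λ t → I (S t) → I (S (suc t))) step (λ t R≤t → subst I (sym (S-after R≤t))) t (I-S t)
    where
    step : ∀ r → I (S (toℕ r)) → I (S (suc (toℕ r)))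
    step r IS with greedy r
    ... | inj₁ (cr , _)          = subst I (sym (S-round-idle cr)) IS
    ... | inj₂ (x , cr , (_ , Ix) , _) = subst I (sym (S-round cr)) Ix

  growth : ∀ t → ∣ S (suc t) ∣ ≡ suc ∣ S t ∣ ⊎ δ t ≡ 0ℚ
  growth = round-or-after _ at-round (λ t R≤t → inj₂ (δ≡0 (S-after R≤t)))
    where
    at-round : ∀ r → ∣ S (suc (toℕ r)) ∣ ≡ suc ∣ S (toℕ r) ∣ ⊎ δ (toℕ r) ≡ 0ℚ
    at-round r with greedy r
    ... | inj₁ (cr , _) = inj₂ (δ≡0 (S-round-idle cr))
    ... | inj₂ (x , cr , (avail , _) , _) =
      inj₁ (trans (cong ∣_∣ (S-round cr)) (∣p∪⁅x⁆∣≡1+∣p∣ (S (toℕ r)) (available⇒∉S avail)))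

  δ-anti-rounds : ∀ {r r′ : Fin R} → toℕ r ℕ.< toℕ r′ → δ (toℕ r′) ≤ δ (toℕ r)
  δ-anti-rounds {r} {r′} r<r′ with greedy r′
  ... | inj₁ (cr′ , _) = ≤-trans (≤-reflexive (δ≡0 (S-round-idle cr′))) (0≤δ (toℕ r))
  ... | inj₂ (x , cr′ , (avail , Ix) , _) = begin
    δ (toℕ r′)             ≡⟨ δ-round cr′ ⟩
    marg f x (S (toℕ r′))  ≤⟨ submodular (S (toℕ r)) (S (toℕ r′)) x S⊆S′ (available⇒∉S avail) ⟩
    marg f x (S (toℕ r))   ≤⟨ greedy-bound r (Available-anti (inj₁ r<r′) avail) (down _ _ S∪x⊆S′∪x Ix) ⟩
    δ (toℕ r)              ∎
    where
    open ≤-Reasoning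
    S⊆S′ : S (toℕ r) ⊆ S (toℕ r′)
    S⊆S′ = pickedBefore-mono c (ℕP.<⇒≤ r<r′)
    S∪x⊆S′∪x : S (toℕ r) ∪ ⁅ x ⁆ ⊆ S (toℕ r′) ∪ ⁅ x ⁆
    S∪x⊆S′∪x = ∪-least (p⊆p∪q ⁅ x ⁆ ∘ S⊆S′) (q⊆p∪q _ ⁅ x ⁆)

  δ-anti : ∀ t → δ (suc t) ≤ δ t
  δ-anti t with suc t ℕ.<? R
  ... | no  t+1≮R = ≤-trans (≤-reflexive (δ≡0 (S-after (ℕP.≮⇒≥ t+1≮R)))) (0≤δ t)
  ... | yes t+1<R = subst₂ (λ u v → δ u ≤ δ v) (FinP.toℕ-fromℕ< t+1<R) (FinP.toℕ-fromℕ< t<R) (δ-anti-rounds r<r′)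
    where
    t<R : t ℕ.< R
    t<R = ℕP.<-trans (ℕP.n<1+n t) t+1<R
    r<r′ : toℕ (fromℕ< t<R) ℕ.< toℕ (fromℕ< t+1<R)
    r<r′ = subst₂ ℕ._<_ (sym (FinP.toℕ-fromℕ< t<R)) (sym (FinP.toℕ-fromℕ< t+1<R)) (ℕP.n<1+n t)

firstPick-head : ∀ {m R} (s : Fin (suc R) → Maybe (Fin m)) {x} → s zero ≡ just x → firstPick (suc R) s ≡ just x
firstPick-head s s0 rewrite s0 = refl

firstPick-or-late : ∀ {m R} (s : Fin R → Maybe (Fin m)) u {x} → s u ≡ just x → firstPick R s ≡ just x ⊎ 1 ℕ.≤ toℕ u
firstPick-or-late s zero    su = inj₁ (firstPick-head s su)
firstPick-or-late s (suc u) _  = inj₂ (ℕ.s≤s ℕ.z≤n)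

module _ {m n} (c : Run m n) where

  ∈removeFirst⇒late : ∀ {j o} → o ∈ removeFirst c j → ∃[ u ] (c u j ≡ just o × 1 ℕ.≤ toℕ u)
  ∈removeFirst⇒late {j} {o} o∈ with firstPick (rounds m n) (λ r → c r j) in first
  ... | just g with x∈p─q⁻ (selected c j) ⁅ g ⁆ o∈
  ...   | o∈S , o∉⁅g⁆ with ∈-selected⁻ c o∈S
  ...     | u , cu with firstPick-or-late (λ r → c r j) u cu
  ...       | inj₁ first≡o = contradiction (subst (_∈ ⁅ g ⁆) (just-injective (trans (sym first) first≡o)) (x∈⁅x⁆ g)) o∉⁅g⁆
  ...       | inj₂ 1≤u     = u , cu , 1≤u
  ∈removeFirst⇒late {j} {o} o∈ | nothing with ∈-selected⁻ c o∈
  ... | u , cu with firstPick-or-late (λ r → c r j) u cu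
  ...   | inj₁ first≡o = case trans (sym first) first≡o of λ ()
  ...   | inj₂ 1≤u     = u , cu , 1≤u

  ∈S′⇒pick : ∀ {i j o} → o ∈ S′ c i j → ∃[ u ] (c u j ≡ just o × (toℕ i ℕ.< toℕ j ⊎ 1 ℕ.≤ toℕ u))
  ∈S′⇒pick {i} {j} o∈ with toℕ i ℕ.<? toℕ j
  ... | yes i<j = let (u , cu) = ∈-selected⁻ c o∈ in u , cu , inj₁ i<j
  ... | no  _   = let (u , cu , 1≤u) = ∈removeFirst⇒late o∈ in u , cu , inj₂ 1≤u

module Opponent {m n} {c : Run m n} (valid : ValidRun c) {i j : Fin n} (j≢i : j ≢ i) where

  R : ℕ
  R = rounds m n

  Precedes : Fin R → ℕ → Set
  Precedes u t = toℕ u ℕ.< t ⊎ (toℕ u ≡ t × toℕ j ℕ.< toℕ i)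

  precedes? : ∀ u t → Dec (Precedes u t)
  precedes? u t = toℕ u ℕ.<? t ⊎-dec (toℕ u ℕ.≟ t ×-dec toℕ j ℕ.<? toℕ i)

  Gone : ℕ → Fin m → Set
  Gone t o = ∃[ u ] (Precedes u t × c u j ≡ just o)

  gone? : ∀ t o → Dec (Gone t o)
  gone? t o = FinP.any? λ u → precedes? u t ×-dec ≡-dec-Maybe Fin._≟_ (c u j) (just o)

  Counted : ℕ → Fin R → Set
  Counted t u = Precedes u t × (toℕ i ℕ.< toℕ j ⊎ 1 ℕ.≤ toℕ u)

  counted? : ∀ t u → Dec (Counted t u)
  counted? t u = precedes? u t ×-dec (toℕ i ℕ.<? toℕ j ⊎-dec 1 ℕ.≤? toℕ u)

  taken : ℕ → Subset m
  taken t = picks (λ u → c u j) (λ u → ⌊ counted? t u ⌋)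

  gone-step : ∀ {t o} → Gone t o → Gone (suc t) o
  gone-step (u , inj₁ u<t , cu)         = u , inj₁ (ℕP.m<n⇒m<1+n u<t) , cu
  gone-step (u , inj₂ (refl , _) , cu) = u , inj₁ (ℕP.n<1+n _) , cu

  ¬gone-zero : ∀ {o} → o ∈ S′ c i j → ¬ Gone 0 o
  ¬gone-zero o∈S′ (u , inj₂ (u≡0 , j<i) , cu) with ∈S′⇒pick c o∈S′
  ... | u′ , cu′ , late with pick-unique valid cu cu′ | late
  ...   | refl | inj₁ i<j = ℕP.<-asym i<j j<i
  ...   | refl | inj₂ 1≤u = ℕP.<⇒≢ 1≤u (sym u≡0)

  gone-final : ∀ {o} → o ∈ S′ c i j → Gone R o
  gone-final o∈S′ with ∈S′⇒pick c o∈S′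
  ... | u , cu , _ = u , inj₁ (FinP.toℕ<n u) , cu

  ¬gone⇒available : ∀ {o r} → o ∈ S′ c i j → ¬ Gone (toℕ r) o → Available c r i o
  ¬gone⇒available {o} {r} o∈S′ ¬gone with ∈S′⇒pick c o∈S′
  ... | u , cu , _ = available-unless-picked-before valid cu j≢i λ before → ¬gone (u , precedes before , cu)
    where
    precedes : Before u j r i → Precedes u (toℕ r)
    precedes (inj₁ u<r)         = inj₁ u<r
    precedes (inj₂ (u≡r , j<i)) = inj₂ (cong toℕ u≡r , j<i)

  gone⇒taken : ∀ {t o} → o ∈ S′ c i j → Gone t o → o ∈ taken t
  gone⇒taken o∈S′ (u , before , cu) with ∈S′⇒pick c o∈S′
  ... | u′ , cu′ , late with pick-unique valid cu cu′
  ...   | refl = ∈-picks⁺ (λ u → c u j) _ u (fromWitness (before , late)) cu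

  ∣taken∣≤ : ∀ t → ∣ taken t ∣ ℕ.≤ t
  ∣taken∣≤ t = by-order (toℕ i ℕ.<? toℕ j)
    where
    width : ∀ l → (∀ {u} → Counted t u → l ℕ.≤ toℕ u × toℕ u ℕ.< l ℕ.+ t) → ∣ taken t ∣ ℕ.≤ t
    width l window = ∣picks∣≤width (λ u → c u j) (λ u → ⌊ counted? t u ⌋) l t λ _ counted → window (toWitness counted)
    by-order : Dec (toℕ i ℕ.< toℕ j) → ∣ taken t ∣ ℕ.≤ t
    by-order (yes i<j) = width 0 λ where
      (inj₁ u<t , _)       → ℕ.z≤n , u<t
      (inj₂ (_ , j<i) , _) → contradiction j<i (ℕP.<-asym i<j)
    by-order (no ¬i<j) = width 1 λ where
      (_ , inj₁ i<j)                → contradiction i<j ¬i<j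
      (inj₁ u<t , inj₂ 1≤u)         → 1≤u , ℕP.m<n⇒m<1+n u<t
      (inj₂ (refl , _) , inj₂ 1≤u) → 1≤u , ℕP.n<1+n _

module DeadItems {m n} {f : SetFun m} {I : Family m} {p : ℚ}
  (monotone : Monotone f) (submodular : Submodular f) (psys : IsPSystem I p) (I? : ∀ X → Dec (I X))
  {c : Run m n} (valid : ValidRun c) {i j : Fin n} (j≢i : j ≢ i) (greedy : Greedy f I c i)
  {O : Subset m} (O⊆S′ : O ⊆ S′ c i j) (IO : I O) where

  open IndependenceSystem (proj₁ psys)
  open GreedyAgent monotone submodular (proj₁ psys) greedy
  open Opponent valid j≢i hiding (R)

  IsDead : ℕ → Fin m → Set
  IsDead t o = o ∈ O × (Gone t o ⊎ ¬ I (S t ∪ ⁅ o ⁆))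

  isDead? : ∀ t o → Dec (IsDead t o)
  isDead? t o = o ∈? O ×-dec (gone? t o ⊎-dec ¬? (I? (S t ∪ ⁅ o ⁆)))

  Dead : ℕ → Subset m
  Dead t = subsetOf (isDead? t)

  IsBlocked : ℕ → Fin m → Set
  IsBlocked t o = o ∈ O × ¬ I (S t ∪ ⁅ o ⁆)

  isBlocked? : ∀ t o → Dec (IsBlocked t o)
  isBlocked? t o = o ∈? O ×-dec ¬? (I? (S t ∪ ⁅ o ⁆))

  Blocked : ℕ → Subset m
  Blocked t = subsetOf (isBlocked? t)

  Dead-zero : Dead 0 ≡ ∅
  Dead-zero = Empty-unique λ (o , o∈) → never-dead (∈-subsetOf⁻ (isDead? 0) o∈)
    where
    never-dead : ∀ {o} → ¬ IsDead 0 o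
    never-dead (o∈O , inj₁ gone)    = ¬gone-zero (O⊆S′ o∈O) gone
    never-dead (o∈O , inj₂ blocked) = blocked (down _ _ (∪-least S0⊆O (x∈p⇒⁅x⁆⊆p o∈O)) IO)
      where
      S0⊆O : S 0 ⊆ O
      S0⊆O x∈ = contradiction (subst (_ ∈_) (pickedBefore-zero c {i}) x∈) ∉⊥

  Dead-step : ∀ t → Dead t ⊆ Dead (suc t)
  Dead-step t o∈ = ∈-subsetOf⁺ (isDead? (suc t)) (still-dead (∈-subsetOf⁻ (isDead? t) o∈))
    where
    still-dead : ∀ {o} → IsDead t o → IsDead (suc t) o
    still-dead (o∈O , inj₁ gone)    = o∈O , inj₁ (gone-step gone)
    still-dead (o∈O , inj₂ blocked) = o∈O , inj₂ λ I′ → blocked (down _ _ S∪o⊆S′∪o I′)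
      where
      S∪o⊆S′∪o : S t ∪ ⁅ _ ⁆ ⊆ S (suc t) ∪ ⁅ _ ⁆
      S∪o⊆S′∪o = ∪-least (p⊆p∪q _ ∘ pickedBefore-mono c (ℕP.n≤1+n t)) (q⊆p∪q _ _)

  O⊆Dead-final : O ⊆ Dead R
  O⊆Dead-final o∈O = ∈-subsetOf⁺ (isDead? R) (o∈O , inj₁ (gone-final (O⊆S′ o∈O)))

  Dead⊆taken∪Blocked : ∀ t → Dead t ⊆ taken t ∪ Blocked t
  Dead⊆taken∪Blocked t o∈ with ∈-subsetOf⁻ (isDead? t) o∈
  ... | o∈O , inj₁ gone    = p⊆p∪q _ (gone⇒taken (O⊆S′ o∈O) gone)
  ... | o∈O , inj₂ blocked = q⊆p∪q _ _ (∈-subsetOf⁺ (isBlocked? t) (o∈O , blocked))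

  ∣Blocked∣≤ : ∀ t → ℕtoℚ ∣ Blocked t ∣ ≤ p * ℕtoℚ ∣ S t ∣
  ∣Blocked∣≤ t = blocked-card {p = p} psys I? (I-S t) (down _ _ (proj₁ ∘ ∈-subsetOf⁻ (isBlocked? t)) IO)
                               λ _ k∈ → proj₂ (∈-subsetOf⁻ (isBlocked? t) k∈)

  Dead-card : ∀ t → ℕtoℚ ∣ Dead t ∣ ≤ ℕtoℚ t + p * ℕtoℚ ∣ S t ∣
  Dead-card t = begin
    ℕtoℚ ∣ Dead t ∣                              ≤⟨ ℕtoℚ-mono (ℕP.≤-trans (p⊆q⇒∣p∣≤∣q∣ (Dead⊆taken∪Blocked t)) (∣p∪q∣≤∣p∣+∣q∣ (taken t) (Blocked t))) ⟩
    ℕtoℚ (∣ taken t ∣ ℕ.+ ∣ Blocked t ∣)          ≡⟨ ℕtoℚ-+ ∣ taken t ∣ ∣ Blocked t ∣ ⟩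
    ℕtoℚ ∣ taken t ∣ + ℕtoℚ ∣ Blocked t ∣         ≤⟨ +-mono-≤ (ℕtoℚ-mono (∣taken∣≤ t)) (∣Blocked∣≤ t) ⟩
    ℕtoℚ t + p * ℕtoℚ ∣ S t ∣                     ∎
    where open ≤-Reasoning

  Dead-charge : ∀ t → t ℕ.< R → ∀ o → o ∈ Dead (suc t) → o ∉ Dead t → marg f o (S t) ≤ δ t
  Dead-charge t t<R o o∈ =
    subst (λ t → o ∉ Dead t → marg f o (S t) ≤ δ t) (FinP.toℕ-fromℕ< t<R) (alive-bound (fromℕ< t<R))
    where
    o∈O : o ∈ O
    o∈O = proj₁ (∈-subsetOf⁻ (isDead? (suc t)) o∈)
    alive-bound : ∀ r → o ∉ Dead (toℕ r) → marg f o (S (toℕ r)) ≤ δ (toℕ r)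
    alive-bound r alive = greedy-bound r (¬gone⇒available (O⊆S′ o∈O) (alive ∘ dead-by-gone)) addable
      where
      dead-by-gone : Gone (toℕ r) o → o ∈ Dead (toℕ r)
      dead-by-gone gone = ∈-subsetOf⁺ (isDead? (toℕ r)) (o∈O , inj₁ gone)
      addable : I (S (toℕ r) ∪ ⁅ o ⁆)
      addable with I? (S (toℕ r) ∪ ⁅ o ⁆)
      ... | yes I∪o = I∪o
      ... | no ¬I∪o = contradiction (∈-subsetOf⁺ (isDead? (toℕ r)) (o∈O , inj₂ ¬I∪o)) alive

  scheme : ChargingScheme f p R S Dead
  scheme = record
    { S-zero    = pickedBefore-zero c {i}
    ; S-step    = λ t → pickedBefore-mono c (ℕP.n≤1+n t)
    ; S⊆S-final = λ t → subst (S t ⊆_) (sym (pickedBefore-all c ℕP.≤-refl)) (pickedBefore⊆selected c)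
    ; gain-anti = δ-anti
    ; growth    = growth
    ; D-zero    = Dead-zero
    ; D-step    = Dead-step
    ; D-card    = Dead-card
    ; D-charge  = Dead-charge
    }

theorem4 : (m n : ℕ) (f : SetFun m) (I : Family m) (p : ℚ)
    → Normalized f → NonNegative f → Monotone f → Submodular f
    → IsPSystem I p
    → (c : Run m n) → ValidRun c
    → (i j : Fin n) → j ≢ i
    → Greedy f I c i
    → ∀ S → Restrict I (S′ c i j) S
    → f S ≤ (p + ℕtoℚ 2) * f (selected c i)
-- Nonnegativity follows from normalization and monotonicity. I need not be decidable, but the goal
-- is, so decidability of I may be assumed under a double negation.
theorem4 m n f I p normalized _ monotone submodular psys c valid i j j≢i greedy O (X , IX , O≡X∩S′) =
  decidable-stable (f O ≤? (p + ℕtoℚ 2) * f (selected c i)) λ ¬bound →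
    ¬¬-decidable m I λ I? → ¬bound (bound I?)
  where
  open IndependenceSystem (proj₁ psys)
  O⊆S′ : O ⊆ S′ c i j
  O⊆S′ = p∩q⊆q X _ ∘ subst (_ ∈_) O≡X∩S′
  IO : I O
  IO = down _ _ (p∩q⊆p X _ ∘ subst (_ ∈_) O≡X∩S′) IX
  bound : (∀ X → Dec (I X)) → f O ≤ (p + ℕtoℚ 2) * f (selected c i)
  bound I? = begin
    f O                                    ≤⟨ monotone _ _ (q⊆p∪q _ _ ∘ O⊆Dead-final) ⟩
    f (pickedBefore c i R ∪ Dead R)        ≤⟨ charging-bound normalized monotone submodular scheme ⟩
    (p + ℕtoℚ 2) * f (pickedBefore c i R)  ≡⟨ cong (λ X → (p + ℕtoℚ 2) * f X) (pickedBefore-all c ℕP.≤-refl) ⟩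
    (p + ℕtoℚ 2) * f (selected c i)        ∎
    where
    open ≤-Reasoning
    open DeadItems {p = p} monotone submodular psys I? valid j≢i greedy O⊆S′ IO
    R = rounds m n
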